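{- Let $a,b,n,t$ be positive integers. Then $$\mathcal F_n^{a,b}=\bigcup_{\mathbf c\in\mathcal C_n^{a,b}}\mathcal E_{\mathbf c}.$$
   Context: For $1\le j\le n$ let $u_j=\min\{a,(n-j)b\}$ and $v_j=\min\{b,(j-1)a\}$. Define $\mathcal C_n^{a,b}=\{(c_1,\ldots,c_n)\in\mathbb Z^n:\ \sum_{i=1}^nc_i=0,\ \sum_{i=1}^jc_i\ge0\text{ and }-tv_j\le c_j\le tu_j\text{ for all }1\le j\le n\}$ and $\mathcal F_n^{a,b}=\{(c_1,\ldots,c_n)\in\mathbb Z^n:\ \sum_{i=1}^nc_i=0,\ -bt\le c_j\le at\text{ for all }1\le j\le n\}$. For $\mathbf c=(c_1,\ldots,c_n)$, $\mathcal E_{\mathbf c}=\{(c_j,\ldots,c_n,c_1,\ldots,c_{j-1}):1\le j\le n\}$ is the set of its cyclic shifts. -}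

module Defs where

open import Data.Nat as ℕ using (ℕ; zero; suc; _∸_; _⊓_)
open import Data.Integer as ℤ using (ℤ; +_; -_; _≤_; 0ℤ)
open import Data.Fin using (Fin; toℕ)
open import Data.Vec using (Vec; []; _∷_; lookup; take; _∷ʳ_)
open import Data.Vec as V using ()
open import Data.Product using (Σ; _×_; ∃-syntax)
open import Relation.Binary.PropositionalEquality using (_≡_)

sumℤ : ∀ {n} → Vec ℤ n → ℤ
sumℤ = V.foldr _ ℤ._+_ 0ℤ

-- prefix sum c_1 + ... + c_{i+1}   (i is the 0-based index, i.e. j = i+1)
prefix : ∀ {n} → Vec ℤ n → Fin n → ℤ
prefix (x ∷ xs) Fin.zero    = x
prefix (x ∷ xs) (Fin.suc i) = x ℤ.+ prefix xs i

-- u_j = min{a, (n-j) b}, v_j = min{b, (j-1) a} with j = toℕ i + 1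
u : ℕ → ℕ → ℕ → ℕ → ℕ
u a b n j = a ⊓ ((n ∸ j) ℕ.* b)

v : ℕ → ℕ → ℕ → ℕ
v a b j = b ⊓ ((j ∸ 1) ℕ.* a)

InC : (a b n t : ℕ) → Vec ℤ n → Set
InC a b n t c =
  sumℤ c ≡ 0ℤ ×
  (∀ (i : Fin n) →
     (0ℤ ≤ prefix c i) ×
     (- (+ (t ℕ.* v a b (suc (toℕ i)))) ≤ lookup c i) ×
     (lookup c i ≤ + (t ℕ.* u a b n (suc (toℕ i)))))

InF : (a b n t : ℕ) → Vec ℤ n → Set
InF a b n t c =
  sumℤ c ≡ 0ℤ ×
  (∀ (i : Fin n) →
     (- (+ (b ℕ.* t)) ≤ lookup c i) × (lookup c i ≤ + (a ℕ.* t)))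

rot : ∀ {A : Set} {n} → Vec A n → Vec A n
rot []       = []
rot (x ∷ xs) = xs ∷ʳ x

rotN : ∀ {A : Set} {n} → ℕ → Vec A n → Vec A n
rotN zero    c = c
rotN (suc k) c = rotN k (rot c)

-- x ∈ E_c : x is a cyclic shift (c_j,...,c_n,c_1,...,c_{j-1}), 1 ≤ j ≤ n (k = j-1)
InE : ∀ {n} → Vec ℤ n → Vec ℤ n → Set
InE {n} c x = ∃[ k ] ((k ℕ.< n) × (x ≡ rotN k c))

{-# OPTIONS --safe #-}
module Submission where

-- Zero sum and the entry bounds -bt ≤ c_j ≤ at survive rotation, and u_j ≤ a, v_j ≤ b, so every
-- rotation of a member of C lies in F. Conversely, rotating x ∈ F so that it starts just after
-- a position where its partial sums are minimal (Raney's cycle lemma) makes all partial sums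
-- nonnegative. For such c, c_j ≥ -(c_1 + ⋯ + c_{j-1}) ≥ -(j-1)at and
-- c_j ≤ c_1 + ⋯ + c_j = -(c_{j+1} + ⋯ + c_n) ≤ (n-j)bt, which with -bt ≤ c_j ≤ at puts c in C.

open import Defs
open import Data.Nat using (ℕ; _≥_)
open import Data.Integer using (ℤ)
open import Data.Vec using (Vec)
open import Data.Product using (Σ; _×_; ∃-syntax; _,_; proj₁; proj₂)
open import Function.Bundles using (_⇔_; mk⇔)

open import Data.Nat as ℕ using (zero; suc; _∸_; _⊓_; s≤s)
import Data.Nat.Properties as ℕ
open import Data.Integer as ℤ using (+_; -_; 0ℤ; _+_; _≤_)
import Data.Integer.Properties as ℤ
open import Data.Fin as Fin using (Fin; toℕ; fromℕ<; inject₁)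
open import Data.Fin.Properties using (toℕ<n; toℕ-fromℕ<)
open import Data.Vec as Vec using ([]; _∷_; lookup; _∷ʳ_; toList)
open import Data.Vec.Properties using (toList-∷ʳ; toList-injective; length-toList; cast-is-id)
open import Data.List as List using (List; []; _∷_; [_]; take; drop; _++_; length)
import Data.List.Properties as List
open import Data.List.Relation.Unary.All as All using ()
open import Data.List.Membership.Propositional.Properties using (∈-allFin)
open import Data.List.Extrema ℤ.≤-totalOrder using (argmin; f[argmin]≤f[xs])
open import Data.Sum using (inj₁; inj₂)
open import Relation.Binary.PropositionalEquality using (_≡_; refl; sym; trans; cong; cong₂; subst; subst₂; module ≡-Reasoning)
open import Relation.Nullary using (yes; no)

private
  variable
    A : Set
    n : ℕ

+-cancelʳ-≤ : ∀ i j k → i + k ≤ j + k → i ≤ j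
+-cancelʳ-≤ i j k i+k≤j+k = subst₂ _≤_ (+k-k i) (+k-k j) (ℤ.+-monoˡ-≤ (- k) i+k≤j+k)
  where
  +k-k : ∀ l → l + k + - k ≡ l
  +k-k l = trans (ℤ.+-assoc l k (- k)) (trans (cong (_+_ l) (ℤ.+-inverseʳ k)) (ℤ.+-identityʳ l))

i≤i+j⇒0≤j : ∀ i j → i ≤ i + j → 0ℤ ≤ j
i≤i+j⇒0≤j i j i≤i+j = +-cancelʳ-≤ 0ℤ j i (subst₂ _≤_ (sym (ℤ.+-identityˡ i)) (ℤ.+-comm i j) i≤i+j)

0≤i+j⇒-i≤j : ∀ i j → 0ℤ ≤ i + j → - i ≤ j
0≤i+j⇒-i≤j i j 0≤i+j = +-cancelʳ-≤ (- i) j i (subst₂ _≤_ (sym (ℤ.+-inverseˡ i)) (ℤ.+-comm i j) 0≤i+j)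

i+j≤0⇒i≤-j : ∀ i j → i + j ≤ 0ℤ → i ≤ - j
i+j≤0⇒i≤-j i j i+j≤0 = +-cancelʳ-≤ i (- j) j (subst (i + j ≤_) (sym (ℤ.+-inverseˡ j)) i+j≤0)

0≤i⇒j≤i+j : ∀ {i} j → 0ℤ ≤ i → j ≤ i + j
0≤i⇒j≤i+j {i} j 0≤i = subst (_≤ i + j) (ℤ.+-identityˡ j) (ℤ.+-monoˡ-≤ j 0≤i)

take-++ : ∀ k (xs ys : List A) → take k (xs ++ ys) ≡ take k xs ++ take (k ∸ length xs) ys
take-++ zero    []       ys = refl
take-++ zero    (x ∷ xs) ys = refl
take-++ (suc k) []       ys = refl
take-++ (suc k) (x ∷ xs) ys = cong (x ∷_) (take-++ k xs ys)

take-++ˡ : ∀ k (xs ys : List A) → k ℕ.≤ length xs → take k (xs ++ ys) ≡ take k xs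
take-++ˡ zero    xs       ys _         = refl
take-++ˡ (suc k) (x ∷ xs) ys (s≤s k≤) = cong (x ∷_) (take-++ˡ k xs ys k≤)

drop-++ˡ : ∀ k (xs ys : List A) → k ℕ.≤ length xs → drop k (xs ++ ys) ≡ drop k xs ++ ys
drop-++ˡ zero    xs       ys _         = refl
drop-++ˡ (suc k) (x ∷ xs) ys (s≤s k≤) = drop-++ˡ k xs ys k≤

take-+ : ∀ j k (xs : List A) → take (j ℕ.+ k) xs ≡ take j xs ++ take k (drop j xs)
take-+ zero    k xs       = refl
take-+ (suc j) k []       = sym (List.take-[] k)
take-+ (suc j) k (x ∷ xs) = cong (x ∷_) (take-+ j k xs)

sumL : List ℤ → ℤ
sumL = List.foldr _+_ 0ℤ

sumL-++ : ∀ xs ys → sumL (xs ++ ys) ≡ sumL xs + sumL ys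
sumL-++ []       ys = sym (ℤ.+-identityˡ (sumL ys))
sumL-++ (x ∷ xs) ys = trans (cong (_+_ x) (sumL-++ xs ys)) (sym (ℤ.+-assoc x (sumL xs) (sumL ys)))

partialSum : List ℤ → ℕ → ℤ
partialSum xs k = sumL (take k xs)

partialSum-++ : ∀ k xs ys → partialSum (xs ++ ys) k ≡ partialSum xs k + partialSum ys (k ∸ length xs)
partialSum-++ k xs ys = trans (cong sumL (take-++ k xs ys)) (sumL-++ (take k xs) _)

partialSum-+ : ∀ j k xs → partialSum xs (j ℕ.+ k) ≡ partialSum xs j + partialSum (drop j xs) k
partialSum-+ j k xs = trans (cong sumL (take-+ j k xs)) (sumL-++ (take j xs) _)

partialSum-rotate-at-minimum-nonneg :
  ∀ (xs : List ℤ) j → sumL xs ≡ 0ℤ → (∀ k → partialSum xs j ≤ partialSum xs k) →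
  ∀ k → 0ℤ ≤ partialSum (drop j xs ++ take j xs) k
partialSum-rotate-at-minimum-nonneg xs j total minimal k with ℕ.≤-total k (length (drop j xs))
... | inj₁ k≤∣D∣ = begin
  0ℤ                                    ≤⟨ i≤i+j⇒0≤j _ _ (subst (partialSum xs j ≤_) (partialSum-+ j k xs) (minimal (j ℕ.+ k))) ⟩
  partialSum (drop j xs) k              ≡⟨ cong sumL (take-++ˡ k (drop j xs) (take j xs) k≤∣D∣) ⟨
  partialSum (drop j xs ++ take j xs) k ∎
  where open ℤ.≤-Reasoning
... | inj₂ ∣D∣≤k = begin
  0ℤ                                              ≡⟨ total ⟨
  sumL xs                                         ≡⟨ cong sumL (List.take++drop≡id j xs) ⟨
  sumL (take j xs ++ D)                           ≡⟨ sumL-++ (take j xs) D ⟩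
  partialSum xs j + sumL D                        ≡⟨ ℤ.+-comm (partialSum xs j) (sumL D) ⟩
  sumL D + partialSum xs j                        ≤⟨ ℤ.+-monoʳ-≤ (sumL D) (minimal (r ⊓ j)) ⟩
  sumL D + partialSum xs (r ⊓ j)                  ≡⟨ cong₂ _+_ (cong sumL (List.take-all k D ∣D∣≤k)) (cong sumL (List.take-take r j xs)) ⟨
  partialSum D k + partialSum (take j xs) r       ≡⟨ partialSum-++ k D (take j xs) ⟨
  partialSum (D ++ take j xs) k                   ∎
  where
  open ℤ.≤-Reasoning
  D : List ℤ
  D = drop j xs
  r : ℕ
  r = k ∸ length D

toList-rotN : ∀ k (xs : Vec A n) → k ℕ.≤ n → toList (rotN k xs) ≡ drop k (toList xs) ++ take k (toList xs)
toList-rotN zero    xs       _         = sym (List.++-identityʳ (toList xs))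
toList-rotN {A = A} (suc k) (x ∷ xs) (s≤s k≤n) = begin
  toList (rotN k (xs ∷ʳ x))                              ≡⟨ toList-rotN k (xs ∷ʳ x) (ℕ.m≤n⇒m≤1+n k≤n) ⟩
  drop k (toList (xs ∷ʳ x)) ++ take k (toList (xs ∷ʳ x)) ≡⟨ cong (λ zs → drop k zs ++ take k zs) (toList-∷ʳ x xs) ⟩
  drop k (ys ++ [ x ]) ++ take k (ys ++ [ x ])           ≡⟨ cong₂ _++_ (drop-++ˡ k ys [ x ] k≤∣ys∣) (take-++ˡ k ys [ x ] k≤∣ys∣) ⟩
  (drop k ys ++ [ x ]) ++ take k ys                      ≡⟨ List.++-assoc (drop k ys) [ x ] (take k ys) ⟩
  drop k ys ++ x ∷ take k ys                             ∎
  where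
  open ≡-Reasoning
  ys : List A
  ys = toList xs
  k≤∣ys∣ : k ℕ.≤ length ys
  k≤∣ys∣ = subst (k ℕ.≤_) (sym (length-toList xs)) k≤n

rotN-+ : ∀ j k (xs : Vec A n) → rotN k (rotN j xs) ≡ rotN (j ℕ.+ k) xs
rotN-+ zero    k xs = refl
rotN-+ (suc j) k xs = rotN-+ j k (rot xs)

rotN-length : (xs : Vec A n) → rotN n xs ≡ xs
rotN-length {n = n} xs = trans (sym (cast-is-id refl (rotN n xs))) (toList-injective refl (rotN n xs) xs (begin
  toList (rotN n xs)                       ≡⟨ toList-rotN n xs ℕ.≤-refl ⟩
  drop n (toList xs) ++ take n (toList xs) ≡⟨ cong₂ _++_ (List.drop-all n (toList xs) ∣xs∣≤n) (List.take-all n (toList xs) ∣xs∣≤n) ⟩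
  toList xs                                ∎))
  where
  open ≡-Reasoning
  ∣xs∣≤n : length (toList xs) ℕ.≤ n
  ∣xs∣≤n = ℕ.≤-reflexive (length-toList xs)

rotN-inverse : ∀ k (xs : Vec A n) → k ℕ.≤ n → rotN (n ∸ k) (rotN k xs) ≡ xs
rotN-inverse {n = n} k xs k≤n = trans (rotN-+ k (n ∸ k) xs) (trans (cong (λ j → rotN j xs) (ℕ.m+[n∸m]≡n k≤n)) (rotN-length xs))

rotN-InE : ∀ k (xs : Vec ℤ n) → k ℕ.< n → InE (rotN k xs) xs
rotN-InE zero    xs 0<n = 0 , 0<n , refl
rotN-InE {n = suc n} (suc k) xs (s≤s k<n) = n ∸ k , s≤s (ℕ.m∸n≤m n k) , sym (rotN-inverse (suc k) xs (ℕ.<⇒≤ (s≤s k<n)))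

lookup-∷ʳ-preserves : ∀ {P : A → Set} (xs : Vec A n) x →
  (∀ i → P (lookup xs i)) → P x → ∀ i → P (lookup (xs ∷ʳ x) i)
lookup-∷ʳ-preserves []       x _   px Fin.zero    = px
lookup-∷ʳ-preserves (y ∷ ys) x pxs px Fin.zero    = pxs Fin.zero
lookup-∷ʳ-preserves {P = P} (y ∷ ys) x pxs px (Fin.suc i) = lookup-∷ʳ-preserves {P = P} ys x (λ j → pxs (Fin.suc j)) px i

lookup-rotN-preserves : ∀ {P : A → Set} k (xs : Vec A n) → (∀ i → P (lookup xs i)) → ∀ i → P (lookup (rotN k xs) i)
lookup-rotN-preserves zero    xs       pxs = pxs
lookup-rotN-preserves (suc k) []       pxs ()
lookup-rotN-preserves {P = P} (suc k) (x ∷ xs) pxs =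
  lookup-rotN-preserves {P = P} k (xs ∷ʳ x) (lookup-∷ʳ-preserves {P = P} xs x (λ j → pxs (Fin.suc j)) (pxs Fin.zero))

sumℤ-∷ʳ : ∀ (xs : Vec ℤ n) x → sumℤ (xs ∷ʳ x) ≡ sumℤ xs + x
sumℤ-∷ʳ []       x = trans (ℤ.+-identityʳ x) (sym (ℤ.+-identityˡ x))
sumℤ-∷ʳ (y ∷ ys) x = trans (cong (_+_ y) (sumℤ-∷ʳ ys x)) (sym (ℤ.+-assoc y (sumℤ ys) x))

sumℤ-rotN : ∀ k (xs : Vec ℤ n) → sumℤ (rotN k xs) ≡ sumℤ xs
sumℤ-rotN zero    xs       = refl
sumℤ-rotN (suc k) []       = sumℤ-rotN k []
sumℤ-rotN (suc k) (x ∷ xs) = trans (sumℤ-rotN k (xs ∷ʳ x)) (trans (sumℤ-∷ʳ xs x) (ℤ.+-comm (sumℤ xs) x))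

sumℤ-toList : (xs : Vec ℤ n) → sumℤ xs ≡ sumL (toList xs)
sumℤ-toList []       = refl
sumℤ-toList (x ∷ xs) = cong (_+_ x) (sumℤ-toList xs)

prefix-toList : (xs : Vec ℤ n) (i : Fin n) → prefix xs i ≡ partialSum (toList xs) (suc (toℕ i))
prefix-toList (x ∷ xs) Fin.zero    = sym (ℤ.+-identityʳ x)
prefix-toList (x ∷ xs) (Fin.suc i) = cong (_+_ x) (prefix-toList xs i)

minimiser : (f : Fin (suc n) → ℤ) → ∃[ j ] (∀ k → f j ≤ f k)
minimiser f = argmin f Fin.zero (List.allFin _) ,
  λ k → All.lookup (f[argmin]≤f[xs] {f = f} Fin.zero (List.allFin _)) (∈-allFin k)

cycle-lemma : (xs : Vec ℤ (suc n)) → sumℤ xs ≡ 0ℤ → ∃[ k ] (k ℕ.< suc n × (∀ i → 0ℤ ≤ prefix (rotN k xs) i))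
cycle-lemma {n} xs total = toℕ j , toℕ<n j , prefix-nonneg
  where
  open ℤ.≤-Reasoning
  ys : List ℤ
  ys = toList xs
  sumL≡0 : sumL ys ≡ 0ℤ
  sumL≡0 = trans (sym (sumℤ-toList xs)) total
  min : ∃[ j ] (∀ k → partialSum ys (toℕ j) ≤ partialSum ys (toℕ k))
  min = minimiser (λ k → partialSum ys (toℕ k))
  j : Fin (suc n)
  j = proj₁ min
  minimal : ∀ k → partialSum ys (toℕ j) ≤ partialSum ys k
  minimal k with k ℕ.<? suc n
  ... | yes k<n = subst (λ l → partialSum ys (toℕ j) ≤ partialSum ys l) (toℕ-fromℕ< k<n) (proj₂ min (fromℕ< k<n))
  ... | no  k≮n = subst (partialSum ys (toℕ j) ≤_) (sym (trans (cong sumL (List.take-all k ys ∣ys∣≤k)) sumL≡0)) (proj₂ min Fin.zero)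
    where
    ∣ys∣≤k : length ys ℕ.≤ k
    ∣ys∣≤k = subst (ℕ._≤ k) (sym (length-toList xs)) (ℕ.≮⇒≥ k≮n)
  nonneg : ∀ k → 0ℤ ≤ partialSum (drop (toℕ j) ys ++ take (toℕ j) ys) k
  nonneg = partialSum-rotate-at-minimum-nonneg ys (toℕ j) sumL≡0 minimal
  prefix-nonneg : ∀ i → 0ℤ ≤ prefix (rotN (toℕ j) xs) i
  prefix-nonneg i = begin
    0ℤ                                                ≤⟨ nonneg k ⟩
    partialSum (drop (toℕ j) ys ++ take (toℕ j) ys) k ≡⟨ cong (λ zs → partialSum zs k) (toList-rotN (toℕ j) xs (ℕ.<⇒≤ (toℕ<n j))) ⟨
    partialSum (toList (rotN (toℕ j) xs)) k           ≡⟨ prefix-toList (rotN (toℕ j) xs) i ⟨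
    prefix (rotN (toℕ j) xs) i                        ∎
    where
    k : ℕ
    k = suc (toℕ i)

before : Vec ℤ n → Fin n → ℤ
before (x ∷ xs) Fin.zero    = 0ℤ
before (x ∷ xs) (Fin.suc i) = x + before xs i

after : Vec ℤ n → Fin n → ℤ
after (x ∷ xs) Fin.zero    = sumℤ xs
after (x ∷ xs) (Fin.suc i) = after xs i

prefix-split : (xs : Vec ℤ n) (i : Fin n) → prefix xs i ≡ before xs i + lookup xs i
prefix-split (x ∷ xs) Fin.zero    = sym (ℤ.+-identityˡ x)
prefix-split (x ∷ xs) (Fin.suc i) = trans (cong (_+_ x) (prefix-split xs i)) (sym (ℤ.+-assoc x (before xs i) (lookup xs i)))

sumℤ-split : (xs : Vec ℤ n) (i : Fin n) → sumℤ xs ≡ prefix xs i + after xs i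
sumℤ-split (x ∷ xs) Fin.zero    = refl
sumℤ-split (x ∷ xs) (Fin.suc i) = trans (cong (_+_ x) (sumℤ-split xs i)) (sym (ℤ.+-assoc x (prefix xs i) (after xs i)))

before-suc : ∀ x (xs : Vec ℤ n) i → before (x ∷ xs) (Fin.suc i) ≡ prefix (x ∷ xs) (inject₁ i)
before-suc x (y ∷ ys) Fin.zero    = ℤ.+-identityʳ x
before-suc x (y ∷ ys) (Fin.suc i) = cong (_+_ x) (before-suc y ys i)

before-nonneg : (xs : Vec ℤ n) → (∀ i → 0ℤ ≤ prefix xs i) → ∀ i → 0ℤ ≤ before xs i
before-nonneg (x ∷ xs) nonneg Fin.zero    = ℤ.≤-refl
before-nonneg (x ∷ xs) nonneg (Fin.suc i) = subst (0ℤ ≤_) (sym (before-suc x xs i)) (nonneg (inject₁ i))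

before-≤ : ∀ a (xs : Vec ℤ n) → (∀ i → lookup xs i ≤ + a) → ∀ i → before xs i ≤ + (toℕ i ℕ.* a)
before-≤ a (x ∷ xs) x≤a Fin.zero    = ℤ.≤-refl
before-≤ a (x ∷ xs) x≤a (Fin.suc i) = ℤ.+-mono-≤ (x≤a Fin.zero) (before-≤ a xs (λ j → x≤a (Fin.suc j)) i)

sumℤ-≥ : ∀ b (xs : Vec ℤ n) → (∀ i → - + b ≤ lookup xs i) → - + (n ℕ.* b) ≤ sumℤ xs
sumℤ-≥ b []       _   = ℤ.≤-refl
sumℤ-≥ {suc n} b (x ∷ xs) b≤x = subst (_≤ x + sumℤ xs) (sym (ℤ.neg-distrib-+ (+ b) (+ (n ℕ.* b))))
  (ℤ.+-mono-≤ (b≤x Fin.zero) (sumℤ-≥ b xs (λ j → b≤x (Fin.suc j))))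

after-≥ : ∀ b (xs : Vec ℤ n) → (∀ i → - + b ≤ lookup xs i) → ∀ i → - + ((n ∸ suc (toℕ i)) ℕ.* b) ≤ after xs i
after-≥ b (x ∷ xs) b≤x Fin.zero    = sumℤ-≥ b xs (λ j → b≤x (Fin.suc j))
after-≥ b (x ∷ xs) b≤x (Fin.suc i) = after-≥ b xs (λ j → b≤x (Fin.suc j)) i

nonneg-prefix⇒lookup-≥ : ∀ a (xs : Vec ℤ n) → (∀ i → lookup xs i ≤ + a) →
  ∀ i → 0ℤ ≤ prefix xs i → - + (toℕ i ℕ.* a) ≤ lookup xs i
nonneg-prefix⇒lookup-≥ a xs x≤a i nonneg = begin
  - + (toℕ i ℕ.* a) ≤⟨ ℤ.neg-mono-≤ (before-≤ a xs x≤a i) ⟩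
  - before xs i     ≤⟨ 0≤i+j⇒-i≤j _ _ (subst (0ℤ ≤_) (prefix-split xs i) nonneg) ⟩
  lookup xs i       ∎
  where open ℤ.≤-Reasoning

nonneg-prefix⇒lookup-≤ : ∀ b (xs : Vec ℤ n) → (∀ i → - + b ≤ lookup xs i) → sumℤ xs ≡ 0ℤ →
  (∀ i → 0ℤ ≤ prefix xs i) → ∀ i → lookup xs i ≤ + ((n ∸ suc (toℕ i)) ℕ.* b)
nonneg-prefix⇒lookup-≤ {n} b xs b≤x total nonneg i = begin
  lookup xs i                          ≤⟨ 0≤i⇒j≤i+j _ (before-nonneg xs nonneg i) ⟩
  before xs i + lookup xs i            ≡⟨ prefix-split xs i ⟨
  prefix xs i                          ≤⟨ i+j≤0⇒i≤-j _ _ (ℤ.≤-reflexive (trans (sym (sumℤ-split xs i)) total)) ⟩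
  - after xs i                         ≤⟨ ℤ.neg-mono-≤ (after-≥ b xs b≤x i) ⟩
  - - + ((n ∸ suc (toℕ i)) ℕ.* b)      ≡⟨ ℤ.neg-involutive _ ⟩
  + ((n ∸ suc (toℕ i)) ℕ.* b)          ∎
  where open ℤ.≤-Reasoning

⊓-preserves : ∀ (P : ℕ → Set) {x y} → P x → P y → P (x ⊓ y)
⊓-preserves P {x} {y} px py with ℕ.⊓-sel x y
... | inj₁ x⊓y≡x = subst P (sym x⊓y≡x) px
... | inj₂ x⊓y≡y = subst P (sym x⊓y≡y) py

m*[n⊓o*p]≡n*m⊓o*[p*m] : ∀ m n o p → m ℕ.* (n ⊓ (o ℕ.* p)) ≡ (n ℕ.* m) ⊓ (o ℕ.* (p ℕ.* m))
m*[n⊓o*p]≡n*m⊓o*[p*m] m n o p = begin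
  m ℕ.* (n ⊓ (o ℕ.* p))              ≡⟨ ℕ.*-comm m (n ⊓ (o ℕ.* p)) ⟩
  (n ⊓ (o ℕ.* p)) ℕ.* m              ≡⟨ ℕ.*-distribʳ-⊓ m n (o ℕ.* p) ⟩
  (n ℕ.* m) ⊓ (o ℕ.* p ℕ.* m)        ≡⟨ cong ((n ℕ.* m) ⊓_) (ℕ.*-assoc o p m) ⟩
  (n ℕ.* m) ⊓ (o ℕ.* (p ℕ.* m))      ∎
  where open ≡-Reasoning

m*[n⊓o*p]≤n*m : ∀ m n o p → m ℕ.* (n ⊓ (o ℕ.* p)) ℕ.≤ n ℕ.* m
m*[n⊓o*p]≤n*m m n o p = ℕ.≤-trans (ℕ.≤-reflexive (m*[n⊓o*p]≡n*m⊓o*[p*m] m n o p)) (ℕ.m⊓n≤m _ _)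

module _ (a b t : ℕ) where

  InF⇒InC : ∀ {n} (xs : Vec ℤ n) → InF a b n t xs → (∀ i → 0ℤ ≤ prefix xs i) → InC a b n t xs
  InF⇒InC {n} xs (total , bounded) nonneg = total , λ i →
    nonneg i ,
    subst (λ w → - + w ≤ lookup xs i) (sym (m*[n⊓o*p]≡n*m⊓o*[p*m] t b (toℕ i) a))
      (⊓-preserves (λ w → - + w ≤ lookup xs i) (proj₁ (bounded i))
        (nonneg-prefix⇒lookup-≥ (a ℕ.* t) xs (λ j → proj₂ (bounded j)) i (nonneg i))) ,
    subst (λ w → lookup xs i ≤ + w) (sym (m*[n⊓o*p]≡n*m⊓o*[p*m] t a (n ∸ suc (toℕ i)) b))
      (⊓-preserves (λ w → lookup xs i ≤ + w) (proj₂ (bounded i))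
        (nonneg-prefix⇒lookup-≤ (b ℕ.* t) xs (λ j → proj₁ (bounded j)) total nonneg i))

  InC⇒InF : ∀ {n} (xs : Vec ℤ n) → InC a b n t xs → InF a b n t xs
  InC⇒InF {n} xs (total , bounded) = total , λ i →
    ℤ.≤-trans (ℤ.neg-mono-≤ (ℤ.+≤+ (m*[n⊓o*p]≤n*m t b (toℕ i) a))) (proj₁ (proj₂ (bounded i))) ,
    ℤ.≤-trans (proj₂ (proj₂ (bounded i))) (ℤ.+≤+ (m*[n⊓o*p]≤n*m t a (n ∸ suc (toℕ i)) b))

  InF-rotN : ∀ {n} k (xs : Vec ℤ n) → InF a b n t xs → InF a b n t (rotN k xs)
  InF-rotN k xs (total , bounded) =
    trans (sumℤ-rotN k xs) total ,
    lookup-rotN-preserves {P = λ x → - + (b ℕ.* t) ≤ x × x ≤ + (a ℕ.* t)} k xs bounded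

lemma5p3 : (a b n t : ℕ) → a ≥ 1 → b ≥ 1 → n ≥ 1 → t ≥ 1 →
    (x : Vec ℤ n) → InF a b n t x ⇔ (∃[ c ] (InC a b n t c × InE c x))
lemma5p3 a b (suc n) t _ _ _ _ x = mk⇔ forward backward
  where
  forward : InF a b (suc n) t x → ∃[ c ] (InC a b (suc n) t c × InE c x)
  forward x∈F with cycle-lemma x (proj₁ x∈F)
  ... | k , k<n , nonneg = rotN k x , InF⇒InC a b t (rotN k x) (InF-rotN a b t k x x∈F) nonneg , rotN-InE k x k<n
  backward : ∃[ c ] (InC a b (suc n) t c × InE c x) → InF a b (suc n) t x
  backward (c , c∈C , k , _ , x≡rotN) = subst (InF a b (suc n) t) (sym x≡rotN) (InF-rotN a b t k c (InC⇒InF a b t c c∈C))
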